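{- Let $\Pi$ be a projective plane of order $q^2$ and let $\pi$ be a Baer subplane of $\Pi$. Let $\phi$ be an embedding of $K_{q^2,q^2}$ into $\Pi$. Then the set $\phi(V(K_{q^2,q^2}))$ contains at most $q^2$ points of $\pi$ if $q>2$, and at most $q^2+1$ points of $\pi$ if $q=2$.
   Context: Graphs are finite, simple and undirected. An embedding of a graph $G=(V,E)$ into a projective plane $\Pi=(\mathcal P,\mathcal L,\mathcal I)$ is an injective map $\phi:V\to\mathcal P$ such that the induced map $E\to\mathcal L$, sending an edge $ab$ to the unique line through $\phi(a)$ and $\phi(b)$, is injective. A subplane of $\Pi$ is a projective plane $(\mathcal P_0,\mathcal L_0,\mathcal I_0)$ with $\mathcal P_0\subseteq\mathcal P$, $\mathcal L_0\subseteq\mathcal L$, $\mathcal I_0\subseteq\mathcal I$; a Baer subplane of a plane of order $q^2$ is a subplane of order $q$. -}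

module Defs where

open import Data.Nat using (ℕ; zero; suc; _+_; _*_)
open import Data.Bool using (Bool; true; false; T; _xor_; if_then_else_)
open import Data.Fin using (Fin; zero; suc; splitAt)
open import Data.Sum using (_⊎_; inj₁; inj₂)
open import Data.Product using (Σ; _×_; _,_; proj₁; proj₂)
open import Data.Empty using (⊥)
open import Relation.Nullary using (¬_)
open import Relation.Binary.PropositionalEquality using (_≡_; _≢_)
open import Function.Bundles using (_↔_)

record IsProjectivePlane (P L : Set) (I : P → L → Bool) : Set where
  field
    line-exists  : (p r : P) → p ≢ r → Σ L λ l → T (I p l) × T (I r l)
    line-unique  : (p r : P) → p ≢ r → (l l′ : L) →
                   T (I p l) → T (I r l) → T (I p l′) → T (I r l′) → l ≡ l′
    point-exists : (l m : L) → l ≢ m → Σ P λ p → T (I p l) × T (I p m)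
    point-unique : (l m : L) → l ≢ m → (p p′ : P) →
                   T (I p l) → T (I p m) → T (I p′ l) → T (I p′ m) → p ≡ p′
    quad : Σ P λ p₁ → Σ P λ p₂ → Σ P λ p₃ → Σ P λ p₄ →
           (p₁ ≢ p₂ × p₁ ≢ p₃ × p₁ ≢ p₄ × p₂ ≢ p₃ × p₂ ≢ p₄ × p₃ ≢ p₄) ×
           ((l : L) → ¬ (T (I p₁ l) × T (I p₂ l) × T (I p₃ l))) ×
           ((l : L) → ¬ (T (I p₁ l) × T (I p₂ l) × T (I p₄ l))) ×
           ((l : L) → ¬ (T (I p₁ l) × T (I p₃ l) × T (I p₄ l))) ×
           ((l : L) → ¬ (T (I p₂ l) × T (I p₃ l) × T (I p₄ l)))

HasOrder : (P L : Set) (I : P → L → Bool) → ℕ → Set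
HasOrder P L I n = (l : L) → Fin (suc n) ↔ Σ P (λ p → T (I p l))

record ProjectivePlane (n : ℕ) : Set₁ where
  field
    Point   : Set
    Line    : Set
    _I_     : Point → Line → Bool
    isPlane : IsProjectivePlane Point Line _I_
    order   : HasOrder Point Line _I_ n

record Subplane {n : ℕ} (Π : ProjectivePlane n) (q : ℕ) : Set₁ where
  open ProjectivePlane Π
  field
    P₀ : Point → Bool
    L₀ : Line → Bool
    I₀ : Point → Line → Bool
    I₀⊆I    : (p : Point) (l : Line) → T (I₀ p l) → T (p I l)
    isPlane : IsProjectivePlane (Σ Point (λ p → T (P₀ p))) (Σ Line (λ l → T (L₀ l)))
                (λ p l → I₀ (proj₁ p) (proj₁ l))
    order   : HasOrder (Σ Point (λ p → T (P₀ p))) (Σ Line (λ l → T (L₀ l)))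
                (λ p l → I₀ (proj₁ p) (proj₁ l)) q

BaerSubplane : (q : ℕ) → ProjectivePlane (q * q) → Set₁
BaerSubplane q Π = Subplane Π q

record Graph (n : ℕ) : Set where
  field
    Adj   : Fin n → Fin n → Bool
    sym   : (a b : Fin n) → Adj a b ≡ Adj b a
    irrefl : (a : Fin n) → Adj a a ≡ false

isLeft : {A B : Set} → A ⊎ B → Bool
isLeft (inj₁ _) = true
isLeft (inj₂ _) = false

-- Complete bipartite graph K_{m,m}: vertices 0..m-1 form one side, m..2m-1 the other.
K : (m : ℕ) → Graph (m + m)
K m = record
  { Adj = λ a b → isLeft (splitAt m a) xor isLeft (splitAt m b)
  ; sym = λ a b → xor-comm (isLeft (splitAt m a)) (isLeft (splitAt m b))
  ; irrefl = λ a → xor-self (isLeft (splitAt m a)) }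
  where
    xor-comm : (x y : Bool) → x xor y ≡ y xor x
    xor-comm false false = _≡_.refl
    xor-comm false true  = _≡_.refl
    xor-comm true  false = _≡_.refl
    xor-comm true  true  = _≡_.refl
    xor-self : (x : Bool) → x xor x ≡ false
    xor-self false = _≡_.refl
    xor-self true  = _≡_.refl

-- Embedding of a graph into a projective plane: injective on vertices, and
-- the induced map edges → lines (edge ab ↦ the unique line through φa, φb)
-- is injective: if edges ab and cd are sent to the same line (i.e. some line
-- passes through φa, φb, φc, φd) then {a,b} = {c,d}.
record Embedding {k n : ℕ} (G : Graph k) (Π : ProjectivePlane n) : Set where
  open Graph G
  open ProjectivePlane Π
  field
    φ : Fin k → Point
    φ-injective : (a b : Fin k) → φ a ≡ φ b → a ≡ b
    edge-injective : (a b c d : Fin k) → T (Adj a b) → T (Adj c d) →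
      (l : Line) → T (φ a I l) → T (φ b I l) → T (φ c I l) → T (φ d I l) →
      (a ≡ c × b ≡ d) ⊎ (a ≡ d × b ≡ c)

count : {k : ℕ} → (Fin k → Bool) → ℕ
count {zero}  f = zero
count {suc k} f = (if f zero then 1 else 0) + count (λ i → f (suc i))

-- Let x be a vertex whose image lies in the Baer subplane π. Since edges go to
-- distinct lines, the neighbours of x with image in π lie on distinct lines of π
-- through φ x, and there are only q + 1 of these; if a second π-vertex x′ lies on
-- the side of x, the line φ x φ x′ is one more line of π through φ x avoided by
-- those neighbours, leaving q. Hence if each side has a π-vertex, either one side
-- has exactly one and the total is at most 1 + (q + 1) ≤ q², or both have two and
-- it is at most q + q ≤ q²; if a side has none, the other side has at most q².
-- So the bound q² holds for all q ≥ 2, which covers the case q = 2 as well.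
module Submission where

open import Defs
open import Data.Nat using (ℕ; zero; suc; _+_; _*_; _≤_; _<_; z≤n; s≤s; s≤s⁻¹)
open import Data.Nat.Properties
  using (≤-refl; ≤-trans; ≤-reflexive; n≤1+n; <⇒≤; m≤n⇒m≤n+o; +-comm; +-identityʳ; +-assoc;
         +-mono-≤; +-monoˡ-≤; *-monoˡ-≤; module ≤-Reasoning)
open import Data.Bool using (Bool; true; false; T; if_then_else_)
open import Data.Unit using (tt)
open import Data.Fin using (Fin; zero; suc; fromℕ<; _↑ˡ_; _↑ʳ_)
open import Data.Fin.Properties
  using (suc-injective; fromℕ<-injective; injective⇒≤;
         ↑ˡ-injective; ↑ʳ-injective; splitAt-↑ˡ; splitAt-↑ʳ)
open import Data.Sum using (inj₁; inj₂)
open import Data.Product using (Σ; _×_; _,_; proj₁; proj₂)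
open import Data.Empty using (⊥-elim)
open import Relation.Nullary using (¬_; yes; no; T?)
open import Relation.Binary.PropositionalEquality using (_≡_; _≢_; refl; sym; trans; cong; subst)
open import Function using (_∘_)
open import Function.Bundles using (Inverse; Injection)
open import Function.Definitions using (Injective)
open import Function.Properties.Inverse using (↔-sym; ↔⇒↣)

count≤ : {k : ℕ} (f : Fin k → Bool) → count f ≤ k
count≤ {zero}  f = z≤n
count≤ {suc k} f with f zero
... | true  = s≤s (count≤ (f ∘ suc))
... | false = ≤-trans (count≤ (f ∘ suc)) (n≤1+n k)

count-↑ : (m n : ℕ) (f : Fin (m + n) → Bool) →
          count f ≡ count (λ i → f (i ↑ˡ n)) + count (λ j → f (m ↑ʳ j))
count-↑ zero    n f = refl
count-↑ (suc m) n f =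
  trans (cong ((if f zero then 1 else 0) +_) (count-↑ m n (f ∘ suc)))
        (sym (+-assoc (if f zero then 1 else 0) _ _))

record DistinctWitnesses {k : ℕ} (f : Fin k → Bool) (n : ℕ) : Set where
  field
    witness           : Fin n → Fin k
    witness-injective : Injective _≡_ _≡_ witness
    witness-true      : (i : Fin n) → T (f (witness i))

enumerate : {k : ℕ} (f : Fin k → Bool) → DistinctWitnesses f (count f)
enumerate {zero} f = record { witness = λ () ; witness-injective = λ {} ; witness-true = λ () }
enumerate {suc k} f with f zero in f0 | enumerate (f ∘ suc)
... | false | W = record
  { witness           = suc ∘ witness
  ; witness-injective = witness-injective ∘ suc-injective
  ; witness-true      = witness-true
  }
  where open DistinctWitnesses W
... | true | W = record { witness = w ; witness-injective = w-injective ; witness-true = w-true }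
  where
  open DistinctWitnesses W
  w : Fin (suc (count (f ∘ suc))) → Fin (suc k)
  w zero    = zero
  w (suc i) = suc (witness i)
  w-injective : Injective _≡_ _≡_ w
  w-injective {zero}  {zero}  _  = refl
  w-injective {suc i} {suc j} eq = cong suc (witness-injective (suc-injective eq))
  w-true : (i : Fin (suc (count (f ∘ suc)))) → T (f (w i))
  w-true zero    = subst T (sym f0) tt
  w-true (suc i) = witness-true i

count-witness : {k : ℕ} (f : Fin k → Bool) → 0 < count f → Σ (Fin k) (T ∘ f)
count-witness f 0<c = witness i₀ , witness-true i₀
  where
  open DistinctWitnesses (enumerate f)
  i₀ : Fin (count f)
  i₀ = fromℕ< 0<c

count-two-witnesses : {k : ℕ} (f : Fin k → Bool) → 1 < count f →
                      Σ (Fin k) λ i → Σ (Fin k) λ j → i ≢ j × T (f i) × T (f j)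
count-two-witnesses f 1<c =
  witness i₀ , witness i₁ , (λ eq → 0≢1 (witness-injective eq)) , witness-true i₀ , witness-true i₁
  where
  open DistinctWitnesses (enumerate f)
  i₀ i₁ : Fin (count f)
  i₀ = fromℕ< (<⇒≤ 1<c)
  i₁ = fromℕ< 1<c
  0≢1 : i₀ ≢ i₁
  0≢1 eq with fromℕ<-injective 0 1 (<⇒≤ 1<c) 1<c eq
  ... | ()

count≤-injection : {k n : ℕ} (f : Fin k → Bool) (h : (i : Fin k) → T (f i) → Fin n) →
                   (∀ {i j} ti tj → h i ti ≡ h j tj → i ≡ j) → count f ≤ n
count≤-injection f h h-injective =
  injective⇒≤ (witness-injective ∘ h-injective (witness-true _) (witness-true _))
  where open DistinctWitnesses (enumerate f)

-- Prepending a true entry, taken to o, turns the injection into one of size count f + 1.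
count<-injection : {k n : ℕ} (f : Fin k → Bool) (h : (i : Fin k) → T (f i) → Fin n) →
                   (∀ {i j} ti tj → h i ti ≡ h j tj → i ≡ j) →
                   (o : Fin n) → (∀ i ti → h i ti ≢ o) → count f < n
count<-injection {k} {n} f h h-injective o h≢o = count≤-injection f⁺ h⁺ h⁺-injective
  where
  f⁺ : Fin (suc k) → Bool
  f⁺ zero    = true
  f⁺ (suc i) = f i
  h⁺ : (i : Fin (suc k)) → T (f⁺ i) → Fin n
  h⁺ zero    _  = o
  h⁺ (suc i) ti = h i ti
  h⁺-injective : ∀ {i j} ti tj → h⁺ i ti ≡ h⁺ j tj → i ≡ j
  h⁺-injective {zero}  {zero}  _  _  _  = refl
  h⁺-injective {zero}  {suc j} _  tj eq = ⊥-elim (h≢o j tj (sym eq))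
  h⁺-injective {suc i} {zero}  ti _  eq = ⊥-elim (h≢o i ti eq)
  h⁺-injective {suc i} {suc j} ti tj eq = cong suc (h-injective ti tj eq)

q+q≤q*q : {q : ℕ} → 2 ≤ q → q + q ≤ q * q
q+q≤q*q {q} 2≤q = begin
  q + q     ≡⟨ cong (q +_) (sym (+-identityʳ q)) ⟩
  2 * q     ≤⟨ *-monoˡ-≤ q 2≤q ⟩
  q * q     ∎
  where open ≤-Reasoning

2+q≤q*q : {q : ℕ} → 2 ≤ q → 2 + q ≤ q * q
2+q≤q*q {q} 2≤q = ≤-trans (+-monoˡ-≤ q 2≤q) (q+q≤q*q 2≤q)

record SideBound (q other a : ℕ) : Set where
  field
    ≤q*q : a ≤ q * q
    ≤1+q : 0 < other → a ≤ suc q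
    ≤q   : 1 < other → a ≤ q

sum≤q*q : {q : ℕ} (a b : ℕ) → 2 ≤ q → SideBound q b a → SideBound q a b → a + b ≤ q * q
sum≤q*q zero b _ _ B = SideBound.≤q*q B
sum≤q*q {q} a@(suc _) zero _ A _ = subst (_≤ q * q) (sym (+-identityʳ a)) (SideBound.≤q*q A)
sum≤q*q 1 (suc _) 2≤q _ B = ≤-trans (s≤s (SideBound.≤1+q B (s≤s z≤n))) (2+q≤q*q 2≤q)
sum≤q*q a@(suc (suc _)) 1 2≤q A _ =
  ≤-trans (≤-reflexive (+-comm a 1)) (≤-trans (s≤s (SideBound.≤1+q A (s≤s z≤n))) (2+q≤q*q 2≤q))
sum≤q*q (suc (suc _)) (suc (suc _)) 2≤q A B =
  ≤-trans (+-mono-≤ (SideBound.≤q A (s≤s (s≤s z≤n))) (SideBound.≤q B (s≤s (s≤s z≤n)))) (q+q≤q*q 2≤q)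

record Collinear {P L : Set} (I : P → L → Bool) (x y z : P) : Set where
  constructor collinear
  field
    line : L
    x∈line : T (I x line)
    y∈line : T (I y line)
    z∈line : T (I z line)

module _ {P L : Set} {I : P → L → Bool} (plane : IsProjectivePlane P L I) where
  open IsProjectivePlane plane

  -- The three lines p₁p₂, p₃p₄, p₁p₃ of a quadrangle have no common point.
  line-avoiding : (x : P) → Σ L λ m → ¬ T (I x m)
  line-avoiding x with quad
  ... | p₁ , p₂ , p₃ , p₄ , (p₁≢p₂ , p₁≢p₃ , _ , _ , _ , p₃≢p₄) , ¬p₁p₂p₃ , _ , ¬p₁p₃p₄ , _
    with line-exists p₁ p₂ p₁≢p₂ | line-exists p₃ p₄ p₃≢p₄ | line-exists p₁ p₃ p₁≢p₃
  ... | l₁₂ , p₁∈l₁₂ , p₂∈l₁₂ | l₃₄ , p₃∈l₃₄ , p₄∈l₃₄ | l₁₃ , p₁∈l₁₃ , p₃∈l₁₃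
    with T? (I x l₁₂) | T? (I x l₃₄) | T? (I x l₁₃)
  ... | no x∉l₁₂ | _        | _        = l₁₂ , x∉l₁₂
  ... | yes _    | no x∉l₃₄ | _        = l₃₄ , x∉l₃₄
  ... | yes _    | yes _    | no x∉l₁₃ = l₁₃ , x∉l₁₃
  ... | yes x∈l₁₂ | yes x∈l₃₄ | yes x∈l₁₃ =
    ⊥-elim (¬p₁p₃p₄ l₃₄ (subst (λ p → T (I p l₃₄)) x≡p₁ x∈l₃₄ , p₃∈l₃₄ , p₄∈l₃₄))
    where
    l₁₂≢l₁₃ : l₁₂ ≢ l₁₃
    l₁₂≢l₁₃ eq = ¬p₁p₂p₃ l₁₂ (p₁∈l₁₂ , p₂∈l₁₂ , subst (T ∘ I p₃) (sym eq) p₃∈l₁₃)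
    x≡p₁ : x ≡ p₁
    x≡p₁ = point-unique l₁₂ l₁₃ l₁₂≢l₁₃ x p₁ x∈l₁₂ x∈l₁₃ p₁∈l₁₂ p₁∈l₁₃

  module Perspectivity (x : P) (m : L) (x∉m : ¬ T (I x m)) where

    record Projection (y : P) : Set where
      constructor projecting
      field
        ray        : L
        x∈ray      : T (I x ray)
        y∈ray      : T (I y ray)
        image      : P
        image∈ray  : T (I image ray)
        image∈m    : T (I image m)

    project : (y : P) → x ≢ y → Projection y
    project y x≢y with line-exists x y x≢y
    ... | l , x∈l , y∈l with point-exists l m (λ l≡m → x∉m (subst (T ∘ I x) l≡m x∈l))
    ... | z , z∈l , z∈m = projecting l x∈l y∈l z z∈l z∈m

    same-image⇒collinear : {y y′ : P} (p : Projection y) (p′ : Projection y′) →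
                           Projection.image p ≡ Projection.image p′ → Collinear I x y y′
    same-image⇒collinear (projecting l x∈l y∈l z z∈l z∈m)
                         (projecting l′ x∈l′ y′∈l′ .z z∈l′ _) refl =
      collinear l x∈l y∈l (subst (T ∘ I _) (sym l≡l′) y′∈l′)
      where
      x≢z : x ≢ z
      x≢z x≡z = x∉m (subst (λ p → T (I p m)) (sym x≡z) z∈m)
      l≡l′ : l ≡ l′
      l≡l′ = line-unique x z x≢z l l′ x∈l z∈l x∈l′ z∈l′

  -- Lines through x are numbered by their intersections with a line missing x.
  module Pencil {n : ℕ} (order : HasOrder P L I n) (x : P) where
    private
      m : L
      m = proj₁ (line-avoiding x)
      open Perspectivity x m (proj₂ (line-avoiding x))
      number : Σ P (λ p → T (I p m)) → Fin (suc n)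
      number = Inverse.from (order m)
      number-injective : Injective _≡_ _≡_ number
      number-injective = Injection.injective (↔⇒↣ (↔-sym (order m)))

    direction : (y : P) → x ≢ y → Fin (suc n)
    direction y x≢y = number (image , image∈m)
      where open Projection (project y x≢y)

    direction-collinear : {y y′ : P} (x≢y : x ≢ y) (x≢y′ : x ≢ y′) →
                          direction y x≢y ≡ direction y′ x≢y′ → Collinear I x y y′
    direction-collinear x≢y x≢y′ eq =
      same-image⇒collinear (project _ x≢y) (project _ x≢y′) (cong proj₁ (number-injective eq))

    count≤1+n : {k : ℕ} (f : Fin k → Bool) (y : (i : Fin k) → T (f i) → P)
                (x≢y : ∀ i ti → x ≢ y i ti) →
                (∀ {i j} ti tj → Collinear I x (y i ti) (y j tj) → i ≡ j) → count f ≤ suc n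
    count≤1+n f y x≢y separated =
      count≤-injection f (λ i ti → direction _ (x≢y i ti))
        (λ ti tj → separated ti tj ∘ direction-collinear _ _)

    count≤n : {k : ℕ} (f : Fin k → Bool) (y : (i : Fin k) → T (f i) → P)
              (x≢y : ∀ i ti → x ≢ y i ti) →
              (∀ {i j} ti tj → Collinear I x (y i ti) (y j tj) → i ≡ j) →
              (z : P) → x ≢ z → (∀ i ti → ¬ Collinear I x z (y i ti)) → count f ≤ n
    count≤n f y x≢y separated z x≢z ¬xzy =
      s≤s⁻¹ (count<-injection f (λ i ti → direction _ (x≢y i ti))
               (λ ti tj → separated ti tj ∘ direction-collinear _ _)
               (direction z x≢z)
               (λ i ti eq → ¬xzy i ti (direction-collinear x≢z (x≢y i ti) (sym eq))))

module EmbeddedNeighbours {k n q : ℕ} {G : Graph k} {Π : ProjectivePlane n}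
                          (π : Subplane Π q) (E : Embedding G Π) where
  open Graph G
  open ProjectivePlane Π using (Point; Line; _I_)
  open Subplane π
  open Embedding E

  adjacent⇒≢ : {u v : Fin k} → T (Adj u v) → u ≢ v
  adjacent⇒≢ {u} u~v refl = subst T (irrefl u) u~v

  collinear-neighbours⇒≡ : {x u v : Fin k} → T (Adj x u) → T (Adj x v) →
                           Collinear _I_ (φ x) (φ u) (φ v) → u ≡ v
  collinear-neighbours⇒≡ {x} {u} {v} x~u x~v (collinear l x∈l u∈l v∈l)
    with edge-injective x u x v x~u x~v l x∈l u∈l x∈l v∈l
  ... | inj₁ (_ , u≡v) = u≡v
  ... | inj₂ (x≡v , _) = ⊥-elim (adjacent⇒≢ x~v x≡v)

  collinear-common-neighbour⇒≡ : {x x′ u : Fin k} → T (Adj x u) → T (Adj x′ u) →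
                                 Collinear _I_ (φ x) (φ x′) (φ u) → x ≡ x′
  collinear-common-neighbour⇒≡ {x} {x′} {u} x~u x′~u (collinear l x∈l x′∈l u∈l)
    with edge-injective x u x′ u x~u x′~u l x∈l u∈l x′∈l u∈l
  ... | inj₁ (x≡x′ , _) = x≡x′
  ... | inj₂ (x≡u , _)  = ⊥-elim (adjacent⇒≢ x~u x≡u)

  private
    Pointπ : Set
    Pointπ = Σ Point (T ∘ P₀)
    _Iπ_ : Pointπ → Σ Line (T ∘ L₀) → Bool
    p Iπ l = I₀ (proj₁ p) (proj₁ l)
    open Pencil isPlane order using (count≤1+n; count≤n)

    collinearπ⇒collinear : {p p′ p″ : Pointπ} → Collinear _Iπ_ p p′ p″ →
                           Collinear _I_ (proj₁ p) (proj₁ p′) (proj₁ p″)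
    collinearπ⇒collinear (collinear (l , _) p∈l p′∈l p″∈l) =
      collinear l (I₀⊆I _ _ p∈l) (I₀⊆I _ _ p′∈l) (I₀⊆I _ _ p″∈l)

    pointπ : (v : Fin k) → T (P₀ (φ v)) → Pointπ
    pointπ v tv = φ v , tv

    ≢⇒≢π : {u v : Fin k} (tu : T (P₀ (φ u))) (tv : T (P₀ (φ v))) →
           u ≢ v → pointπ u tu ≢ pointπ v tv
    ≢⇒≢π {u} {v} _ _ u≢v eq = u≢v (φ-injective u v (cong proj₁ eq))

  count-neighbours-in-π≤1+q :
    (x : Fin k) → T (P₀ (φ x)) → {m : ℕ} (g : Fin m → Fin k) → Injective _≡_ _≡_ g →
    (∀ j → T (Adj x (g j))) → count (λ j → P₀ (φ (g j))) ≤ suc q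
  count-neighbours-in-π≤1+q x tx g g-injective x~g =
    count≤1+n (pointπ x tx) _ (pointπ ∘ g)
      (λ j tj → ≢⇒≢π tx tj (adjacent⇒≢ (x~g j)))
      (λ _ _ → g-injective ∘ collinear-neighbours⇒≡ (x~g _) (x~g _) ∘ collinearπ⇒collinear)

  count-common-neighbours-in-π≤q :
    (x x′ : Fin k) → x ≢ x′ → T (P₀ (φ x)) → T (P₀ (φ x′)) →
    {m : ℕ} (g : Fin m → Fin k) → Injective _≡_ _≡_ g →
    (∀ j → T (Adj x (g j))) → (∀ j → T (Adj x′ (g j))) → count (λ j → P₀ (φ (g j))) ≤ q
  count-common-neighbours-in-π≤q x x′ x≢x′ tx tx′ g g-injective x~g x′~g =
    count≤n (pointπ x tx) _ (pointπ ∘ g)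
      (λ j tj → ≢⇒≢π tx tj (adjacent⇒≢ (x~g j)))
      (λ _ _ → g-injective ∘ collinear-neighbours⇒≡ (x~g _) (x~g _) ∘ collinearπ⇒collinear)
      (pointπ x′ tx′) (≢⇒≢π tx tx′ x≢x′)
      (λ j _ → x≢x′ ∘ collinear-common-neighbour⇒≡ (x~g j) (x′~g j) ∘ collinearπ⇒collinear)

module _ (m : ℕ) where
  open Graph (K m)

  left-right-adjacent : (i j : Fin m) → T (Adj (i ↑ˡ m) (m ↑ʳ j))
  left-right-adjacent i j rewrite splitAt-↑ˡ m i m | splitAt-↑ʳ m m j = tt

  right-left-adjacent : (j i : Fin m) → T (Adj (m ↑ʳ j) (i ↑ˡ m))
  right-left-adjacent j i rewrite splitAt-↑ˡ m i m | splitAt-↑ʳ m m j = tt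

module _ (q : ℕ) (Π : ProjectivePlane (q * q)) (π : BaerSubplane q Π)
         (E : Embedding (K (q * q)) Π) where
  open Subplane π using (P₀)
  open Embedding E using (φ)
  open EmbeddedNeighbours π E

  side-bound : (g h : Fin (q * q) → Fin (q * q + q * q)) →
               Injective _≡_ _≡_ g → Injective _≡_ _≡_ h →
               (∀ j i → T (Graph.Adj (K (q * q)) (h j) (g i))) →
               SideBound q (count (P₀ ∘ φ ∘ h)) (count (P₀ ∘ φ ∘ g))
  side-bound g h g-injective h-injective h~g = record
    { ≤q*q = count≤ (P₀ ∘ φ ∘ g)
    ; ≤1+q = λ 0<c → let (j , tj) = count-witness (P₀ ∘ φ ∘ h) 0<c in
               count-neighbours-in-π≤1+q (h j) tj g g-injective (h~g j)
    ; ≤q   = λ 1<c → let (j , j′ , j≢j′ , tj , tj′) = count-two-witnesses (P₀ ∘ φ ∘ h) 1<c in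
               count-common-neighbours-in-π≤q (h j) (h j′) (j≢j′ ∘ h-injective) tj tj′ g g-injective
                 (h~g j) (h~g j′)
    }

  count-in-π≤q*q : 2 ≤ q → count (P₀ ∘ φ) ≤ q * q
  count-in-π≤q*q 2≤q rewrite count-↑ (q * q) (q * q) (P₀ ∘ φ) =
    sum≤q*q _ _ 2≤q
      (side-bound left right (↑ˡ-injective N _ _) (↑ʳ-injective N _ _) (right-left-adjacent N))
      (side-bound right left (↑ʳ-injective N _ _) (↑ˡ-injective N _ _) (left-right-adjacent N))
    where
    N : ℕ
    N = q * q
    left right : Fin N → Fin (N + N)
    left  = _↑ˡ N
    right = N ↑ʳ_

lemma4p9 : (q : ℕ) (Π : ProjectivePlane (q * q)) (π : BaerSubplane q Π)
           (e : Embedding (K (q * q)) Π) →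
           let c = count (λ v → Subplane.P₀ π (Embedding.φ e v)) in
           (2 < q → c ≤ q * q) × (q ≡ 2 → c ≤ q * q + 1)
lemma4p9 q Π π e =
  count-in-π≤q*q q Π π e ∘ <⇒≤ ,
  λ { refl → m≤n⇒m≤n+o 1 (count-in-π≤q*q 2 Π π e ≤-refl) }
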